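{- Let a principal MS-algebra $L$ be a perfect extension of its greatest Stone subalgebra $L_S$. Then the congruence lattices $\mathrm{Con}(L)$ and $\mathrm{Con}(L_S)$ are isomorphic.
   Context: An MS-algebra is an algebra $(L;\vee,\wedge,{}^{\circ},0,1)$ where $(L;\vee,\wedge,0,1)$ is a bounded distributive lattice and ${}^{\circ}$ is a unary operation with $x\le x^{\circ\circ}$, $(x\wedge y)^{\circ}=x^{\circ}\vee y^{\circ}$ and $1^{\circ}=0$. For an MS-algebra $L$, $D(L)=\{x\mid x^{\circ}=0\}$ and $L_S=\{x\mid x^{\circ}\vee x^{\circ\circ}=1\}$ is the greatest Stone subalgebra of $L$. $L$ is a principal MS-algebra if there is $d_L$ with $D(L)=\{x\mid x\ge d_L\}$ and $x=x^{\circ\circ}\wedge(x\vee d_L)$ for all $x$. An algebra $A$ is a perfect extension of a subalgebra $B$ if every congruence of $B$ has exactly one extension to a congruence of $A$. -}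

module Defs where

open import Level using (0ℓ)
open import Data.Unit using (⊤)
open import Data.Product using (Σ; _×_; _,_; proj₁; proj₂)
open import Relation.Binary.PropositionalEquality using (_≡_)
import Algebra.Lattice.Structures as LS
open import Function.Bundles using (_⇔_)

record MSAlgebra : Set₁ where
  infixr 6 _∨_
  infixr 7 _∧_
  infix 8 _°
  field
    Carrier : Set
    _∨_ _∧_ : Carrier → Carrier → Carrier
    _°      : Carrier → Carrier
    𝟘 𝟙     : Carrier
    isDistributiveLattice : LS.IsDistributiveLattice (_≡_ {A = Carrier}) _∨_ _∧_
    ∨-identityʳ : ∀ x → x ∨ 𝟘 ≡ x
    ∧-identityʳ : ∀ x → x ∧ 𝟙 ≡ x
    ms-dn   : ∀ x → x ∧ ((x °) °) ≡ x
    ms-∧    : ∀ x y → (x ∧ y) ° ≡ (x °) ∨ (y °)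
    ms-𝟙    : 𝟙 ° ≡ 𝟘

  _≤_ : Carrier → Carrier → Set
  x ≤ y = x ∧ y ≡ x

  Dense : Carrier → Set
  Dense x = x ° ≡ 𝟘

  -- membership in L_S = { x | x° ∨ x°° = 1 }
  InS : Carrier → Set
  InS x = (x °) ∨ ((x °) °) ≡ 𝟙

  Rel₀ : Set₁
  Rel₀ = Carrier → Carrier → Set

  -- θ is a congruence of the subalgebra of L whose universe is {x | P x}
  -- (θ is only considered on elements satisfying P).
  record IsCongOn (P : Carrier → Set) (θ : Rel₀) : Set where
    field
      refl′  : ∀ {x} → P x → θ x x
      sym′   : ∀ {x y} → P x → P y → θ x y → θ y x
      trans′ : ∀ {x y z} → P x → P y → P z → θ x y → θ y z → θ x z
      ∨-compat : ∀ {a b c d} → P a → P b → P c → P d →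
                 θ a b → θ c d → θ (a ∨ c) (b ∨ d)
      ∧-compat : ∀ {a b c d} → P a → P b → P c → P d →
                 θ a b → θ c d → θ (a ∧ c) (b ∧ d)
      °-compat : ∀ {a b} → P a → P b → θ a b → θ (a °) (b °)

  ConOn : (Carrier → Set) → Set₁
  ConOn P = Σ Rel₀ (IsCongOn P)

  _⊆[_]_ : ∀ {P} → ConOn P → (Carrier → Set) → ConOn P → Set
  θ ⊆[ P ] ψ = ∀ {x y} → P x → P y → proj₁ θ x y → proj₁ ψ x y

  Con : Set₁
  Con = ConOn (λ _ → ⊤)

  _⊆_ : Con → Con → Set
  θ ⊆ ψ = θ ⊆[ (λ _ → ⊤) ] ψ

  ConS : Set₁
  ConS = ConOn InS

  _⊆S_ : ConS → ConS → Set
  θ ⊆S ψ = θ ⊆[ InS ] ψ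

  Extends : Con → ConS → Set
  Extends Φ θ = ∀ {a b} → InS a → InS b → (proj₁ Φ a b ⇔ proj₁ θ a b)

  _≐_ : Con → Con → Set
  Φ ≐ Ψ = ∀ x y → (proj₁ Φ x y ⇔ proj₁ Ψ x y)

  PerfectExtOfS : Set₁
  PerfectExtOfS = (θ : ConS) → Σ Con λ Φ → Extends Φ θ × (∀ Ψ → Extends Ψ θ → Ψ ≐ Φ)

  Principal : Set
  Principal = Σ Carrier λ d →
    (∀ x → (Dense x ⇔ d ≤ x)) × (∀ x → x ≡ ((x °) °) ∧ (x ∨ d))

-- Isomorphism of posets (A, ≤A) and (B, ≤B): mutually inverse monotone maps,
-- where equality of elements is mutual ≤ (congruences are compared as relations).
record OrderIso {A B : Set₁} (_≤A_ : A → A → Set) (_≤B_ : B → B → Set) : Set₁ where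
  field
    to    : A → B
    from  : B → A
    to-mono   : ∀ {x y} → x ≤A y → to x ≤B to y
    from-mono : ∀ {x y} → x ≤B y → from x ≤A from y
    from-to   : ∀ x → (from (to x) ≤A x) × (x ≤A from (to x))
    to-from   : ∀ y → (to (from y) ≤B y) × (y ≤B to (from y))

module Submission where

-- Restriction of congruences, Φ ↦ Φ|L_S, is a monotone map Con(L) → Con(L_S),
-- and every congruence trivially extends its own restriction.  Perfectness
-- supplies the inverse map: θ ↦ ext θ, the unique congruence of L extending θ.
--   * restrict (ext θ) = θ because ext θ extends θ;
--   * ext (restrict Φ) = Φ by uniqueness, since Φ extends restrict Φ;
--   * ext is monotone: if θ ⊆ ψ then ext θ ∩ ext ψ still extends θ, so by
--     uniqueness it equals ext θ, i.e. ext θ ⊆ ext ψ.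

open import Defs
open import Data.Unit using (tt)
open import Data.Product using (Σ; _×_; _,_; proj₁; proj₂)
open import Function.Bundles using (Equivalence; mk⇔)

module CongruenceFacts (L : MSAlgebra) where
  open MSAlgebra L

  restrict : ∀ {P} → Con → ConOn P
  restrict (R , c) = R , record
    { refl′    = λ _ → refl′ tt
    ; sym′     = λ _ _ → sym′ tt tt
    ; trans′   = λ _ _ _ → trans′ tt tt tt
    ; ∨-compat = λ _ _ _ _ → ∨-compat tt tt tt tt
    ; ∧-compat = λ _ _ _ _ → ∧-compat tt tt tt tt
    ; °-compat = λ _ _ → °-compat tt tt
    }
    where open IsCongOn c

  restrict-mono : ∀ {P} {Φ Ψ : Con} → Φ ⊆ Ψ →
                  restrict {P} Φ ⊆[ P ] restrict {P} Ψ
  restrict-mono Φ⊆Ψ _ _ = Φ⊆Ψ tt tt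

  extends-restrict : ∀ (Φ : Con) → Extends Φ (restrict {InS} Φ)
  extends-restrict Φ _ _ = mk⇔ (λ r → r) (λ r → r)

  _∩_ : ∀ {P} → ConOn P → ConOn P → ConOn P
  (R , c) ∩ (S , d) = (λ x y → R x y × S x y) , record
    { refl′    = λ p → C.refl′ p , D.refl′ p
    ; sym′     = λ p q (r , s) → C.sym′ p q r , D.sym′ p q s
    ; trans′   = λ p q u (r , s) (r′ , s′) → C.trans′ p q u r r′ , D.trans′ p q u s s′
    ; ∨-compat = λ p q u v (r , s) (r′ , s′) →
                   C.∨-compat p q u v r r′ , D.∨-compat p q u v s s′
    ; ∧-compat = λ p q u v (r , s) (r′ , s′) →
                   C.∧-compat p q u v r r′ , D.∧-compat p q u v s s′
    ; °-compat = λ p q (r , s) → C.°-compat p q r , D.°-compat p q s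
    }
    where module C = IsCongOn c
          module D = IsCongOn d

  ∩-extends : ∀ (Φ Ψ : Con) {θ ψ : ConS} →
              Extends Φ θ → Extends Ψ ψ → θ ⊆S ψ → Extends (Φ ∩ Ψ) θ
  ∩-extends _ _ Φ⊒θ Ψ⊒ψ θ⊆ψ p q = mk⇔
    (λ (r , _) → Equivalence.to (Φ⊒θ p q) r)
    (λ t → Equivalence.from (Φ⊒θ p q) t , Equivalence.from (Ψ⊒ψ p q) (θ⊆ψ p q t))

  module Perfect (perfect : PerfectExtOfS) where

    ext : ConS → Con
    ext θ = proj₁ (perfect θ)

    ext-extends : ∀ θ → Extends (ext θ) θ
    ext-extends θ = proj₁ (proj₂ (perfect θ))

    ext-unique : ∀ θ Ψ → Extends Ψ θ → Ψ ≐ ext θ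
    ext-unique θ = proj₂ (proj₂ (perfect θ))

    restrict-ext : ∀ θ → (restrict (ext θ) ⊆S θ) × (θ ⊆S restrict (ext θ))
    restrict-ext θ = (λ p q → Equivalence.to (ext-extends θ p q))
                   , (λ p q → Equivalence.from (ext-extends θ p q))

    ext-restrict : ∀ Φ → (ext (restrict Φ) ⊆ Φ) × (Φ ⊆ ext (restrict Φ))
    ext-restrict Φ = (λ {x} {y} _ _ → Equivalence.from (Φ≐ x y))
                   , (λ {x} {y} _ _ → Equivalence.to (Φ≐ x y))
      where Φ≐ : Φ ≐ ext (restrict Φ)
            Φ≐ = ext-unique (restrict Φ) Φ (extends-restrict Φ)

    -- Extension is monotone: ext θ = ext θ ∩ ext ψ by uniqueness.
    ext-mono : ∀ {θ ψ} → θ ⊆S ψ → ext θ ⊆ ext ψ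
    ext-mono {θ} {ψ} θ⊆ψ {x} {y} _ _ r =
      proj₂ (Equivalence.from (ext-unique θ (ext θ ∩ ext ψ) ∩-ext x y) r)
      where ∩-ext : Extends (ext θ ∩ ext ψ) θ
            ∩-ext = ∩-extends (ext θ) (ext ψ) {θ} {ψ} (ext-extends θ) (ext-extends ψ) θ⊆ψ

corollary4p6 : (L : MSAlgebra) → MSAlgebra.Principal L → MSAlgebra.PerfectExtOfS L →
    OrderIso (MSAlgebra._⊆_ L) (MSAlgebra._⊆S_ L)
corollary4p6 L _ perfect = record
  { to        = restrict {InS}
  ; from      = ext
  ; to-mono   = λ {Φ} {Ψ} → restrict-mono {Φ = Φ} {Ψ = Ψ}
  ; from-mono = ext-mono
  ; from-to   = ext-restrict
  ; to-from   = restrict-ext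
  }
  where
  open MSAlgebra L using (InS)
  open CongruenceFacts L
  open Perfect perfect
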